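{- Let $\mathcal{O},\mathcal{S}$ be disjoint finite sets, let $Y\ge1$ be an integer, and let $\mathcal A$ be a nonempty collection of pairwise disjoint, nonempty subsets of $\mathcal{O}\cup\mathcal{S}$ such that $\sum_{A\in\mathcal A}\mu(A)=0$ and $|A|\le Y$ for each $A\in\mathcal A$. Then there is a nonempty $\mathcal B\subseteq\mathcal A$ with $|\mathcal B|\le2Y^3$ and $\sum_{B\in\mathcal B}\mu(B)=0$.
   Context: For $A\subseteq\mathcal{O}\cup\mathcal{S}$, the imbalance is $\mu(A)=|A\cap\mathcal{O}|-|A\cap\mathcal{S}|$. -}

module Defs where

open import Data.Bool using (true; false)
open import Data.Nat using (ℕ; suc)
open import Data.Integer using (ℤ; +_; _+_; _-_)
open import Data.Fin using (Fin; zero; suc)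
open import Data.Fin.Subset using (Subset; _∩_; _∈_; ∣_∣)
open import Data.Vec using ([]; _∷_)
open import Data.Empty using (⊥)
open import Data.Product using (_×_)

μ : ∀ {n} → Subset n → Subset n → Subset n → ℤ
μ O S A = + ∣ A ∩ O ∣ - + ∣ A ∩ S ∣

Disjoint : ∀ {n} → Subset n → Subset n → Set
Disjoint A B = ∀ x → x ∈ A → x ∈ B → ⊥

sumOver : ∀ {m} → Subset m → (Fin m → ℤ) → ℤ
sumOver [] f = + 0
sumOver (true ∷ B) f = f zero + sumOver B (λ i → f (suc i))
sumOver (false ∷ B) f = sumOver B (λ i → f (suc i))

module Submission where

-- If some μ(A) vanishes, {A} works, and if |𝒜| ≤ 2Y³, 𝒜 itself works. Otherwise the values
-- x_A = μ(A) are nonzero with |x_A| ≤ Y, and summing the pointwise bound 1 + x ≤ (Y+1)·[x > 0]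
-- gives |𝒜| ≤ (Y+1)·#{A : x_A > 0}. If every positive value occurred fewer than Y times this
-- would give |𝒜| ≤ (Y+1)Y(Y-1) < Y³; so some positive value p, and symmetrically some negative
-- value -q, each occur at least Y times. Then q sets of imbalance p together with p sets of
-- imbalance -q form a zero-sum subfamily of size p + q ≤ 2Y.

open import Defs
open import Data.Nat using (ℕ; _≤_; _*_; _^_)
open import Data.Integer using (ℤ; +_)
open import Data.Fin using (Fin)
open import Data.Fin.Subset using (Subset; _∪_; _⊆_; ∣_∣; Nonempty; ⊤)
open import Relation.Binary.PropositionalEquality using (_≡_; _≢_)
open import Data.Product using (Σ; _×_)

open import Level using (Level; 0ℓ)
open import Function using (_∘_)
open import Data.Empty using (⊥-elim)
open import Data.Bool using (true; false)
open import Data.Product using (_,_; ∃)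
open import Data.Sum using (_⊎_; inj₁; inj₂)
open import Data.Nat as ℕ using (zero; suc; _<_; z≤n; s≤s)
import Data.Nat.Properties as ℕ
open import Data.Nat.Solver using (module +-*-Solver)
open import Data.Integer as ℤ using (-[1+_]; -_)
  renaming (_+_ to _+ℤ_; _*_ to _*ℤ_; _≤_ to _≤ℤ_; _<_ to _<ℤ_; ∣_∣ to ∣_∣ℤ)
import Data.Integer.Properties as ℤ
open import Algebra.Properties.CommutativeSemigroup ℤ.+-commutativeSemigroup using (x∙yz≈y∙xz; interchange)
open import Data.Fin using (zero; suc)
open import Data.Fin.Properties using (any?)
open import Data.Fin.Subset using (_∈_; _∩_; ⊥; ⁅_⁆)
import Data.Fin.Subset.Properties as Subset
open import Data.Vec using (Vec; []; _∷_; here; there; tabulate; count)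
open import Relation.Unary using (Pred; Decidable)
open import Relation.Nullary using (yes; no; ¬_; _×-dec_)
open import Relation.Binary.PropositionalEquality using (refl; sym; trans; cong; cong₂; subst; module ≡-Reasoning)

sumOver-const : ∀ {m} (B : Subset m) (f : Fin m → ℤ) {p : ℤ} →
                (∀ {i} → i ∈ B → f i ≡ p) → sumOver B f ≡ + ∣ B ∣ *ℤ p
sumOver-const [] f _ = refl
sumOver-const (true ∷ B) f {p} const = begin
  f zero +ℤ sumOver B (f ∘ suc)   ≡⟨ cong₂ _+ℤ_ (const here) (sumOver-const B (f ∘ suc) (const ∘ there)) ⟩
  p +ℤ + ∣ B ∣ *ℤ p               ≡⟨ sym (ℤ.suc-* (+ ∣ B ∣) p) ⟩
  + suc ∣ B ∣ *ℤ p                ∎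
  where open ≡-Reasoning
sumOver-const (false ∷ B) f const = sumOver-const B (f ∘ suc) (const ∘ there)

sumOver-neg : ∀ {m} (B : Subset m) (f : Fin m → ℤ) → sumOver B (-_ ∘ f) ≡ - sumOver B f
sumOver-neg [] f = refl
sumOver-neg (true ∷ B) f = trans (cong ((- f zero) +ℤ_) (sumOver-neg B (f ∘ suc)))
                                 (sym (ℤ.neg-distrib-+ (f zero) (sumOver B (f ∘ suc))))
sumOver-neg (false ∷ B) f = sumOver-neg B (f ∘ suc)

Disjoint-tail : ∀ {m} {x y} {B C : Subset m} → Disjoint (x ∷ B) (y ∷ C) → Disjoint B C
Disjoint-tail disj i i∈B i∈C = disj (suc i) (there i∈B) (there i∈C)

sumOver-∪ : ∀ {m} (B C : Subset m) (f : Fin m → ℤ) →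
            Disjoint B C → sumOver (B ∪ C) f ≡ sumOver B f +ℤ sumOver C f
sumOver-∪ [] [] f disj = refl
sumOver-∪ (true ∷ B) (true ∷ C) f disj = ⊥-elim (disj zero here here)
sumOver-∪ (true ∷ B) (false ∷ C) f disj = begin
  f zero +ℤ sumOver (B ∪ C) (f ∘ suc)                  ≡⟨ cong (f zero +ℤ_) (sumOver-∪ B C (f ∘ suc) (Disjoint-tail disj)) ⟩
  f zero +ℤ (sumOver B (f ∘ suc) +ℤ sumOver C (f ∘ suc)) ≡⟨ sym (ℤ.+-assoc (f zero) _ _) ⟩
  f zero +ℤ sumOver B (f ∘ suc) +ℤ sumOver C (f ∘ suc)   ∎
  where open ≡-Reasoning
sumOver-∪ (false ∷ B) (true ∷ C) f disj = begin
  f zero +ℤ sumOver (B ∪ C) (f ∘ suc)                  ≡⟨ cong (f zero +ℤ_) (sumOver-∪ B C (f ∘ suc) (Disjoint-tail disj)) ⟩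
  f zero +ℤ (sumOver B (f ∘ suc) +ℤ sumOver C (f ∘ suc)) ≡⟨ x∙yz≈y∙xz (f zero) (sumOver B (f ∘ suc)) (sumOver C (f ∘ suc)) ⟩
  sumOver B (f ∘ suc) +ℤ (f zero +ℤ sumOver C (f ∘ suc)) ∎
  where open ≡-Reasoning
sumOver-∪ (false ∷ B) (false ∷ C) f disj = sumOver-∪ B C (f ∘ suc) (Disjoint-tail disj)

∣p∪q∣≤∣p∣+∣q∣ : ∀ {m} (p q : Subset m) → ∣ p ∪ q ∣ ≤ ∣ p ∣ ℕ.+ ∣ q ∣
∣p∪q∣≤∣p∣+∣q∣ [] [] = z≤n
∣p∪q∣≤∣p∣+∣q∣ (true ∷ p) (false ∷ q) = s≤s (∣p∪q∣≤∣p∣+∣q∣ p q)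
∣p∪q∣≤∣p∣+∣q∣ (true ∷ p) (true ∷ q) =
  s≤s (ℕ.≤-trans (∣p∪q∣≤∣p∣+∣q∣ p q) (ℕ.+-monoʳ-≤ ∣ p ∣ (ℕ.n≤1+n ∣ q ∣)))
∣p∪q∣≤∣p∣+∣q∣ (false ∷ p) (true ∷ q) =
  ℕ.≤-trans (s≤s (∣p∪q∣≤∣p∣+∣q∣ p q)) (ℕ.≤-reflexive (sym (ℕ.+-suc ∣ p ∣ ∣ q ∣)))
∣p∪q∣≤∣p∣+∣q∣ (false ∷ p) (false ∷ q) = ∣p∪q∣≤∣p∣+∣q∣ p q

0<∣p∣⇒Nonempty : ∀ {m} (p : Subset m) → 0 < ∣ p ∣ → Nonempty p
0<∣p∣⇒Nonempty (true ∷ p) _ = zero , here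
0<∣p∣⇒Nonempty (false ∷ p) 0<∣p∣ with 0<∣p∣⇒Nonempty p 0<∣p∣
... | i , i∈p = suc i , there i∈p

private
  variable
    a ℓ ℓ₁ ℓ₂ : Level
    A : Set a

module _ {P : Pred A ℓ} (P? : Decidable P) where

  count-none : (∀ x → ¬ P x) → ∀ {n} (xs : Vec A n) → count P? xs ≡ 0
  count-none none [] = refl
  count-none none (x ∷ xs) with P? x
  ... | yes px = ⊥-elim (none x px)
  ... | no _ = count-none none xs

  count-∷ : ∀ x {n} (xs : Vec A n) → count P? xs ≤ count P? (x ∷ xs)
  count-∷ x xs with P? x
  ... | yes _ = ℕ.n≤1+n (count P? xs)
  ... | no _ = ℕ.≤-refl

  count-∷-yes : ∀ {x} {n} (xs : Vec A n) → P x → count P? (x ∷ xs) ≡ suc (count P? xs)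
  count-∷-yes {x} xs px with P? x
  ... | yes _ = refl
  ... | no ¬px = ⊥-elim (¬px px)

  count-∷-no : ∀ {x} {n} (xs : Vec A n) → ¬ P x → count P? (x ∷ xs) ≡ count P? xs
  count-∷-no {x} xs ¬px with P? x
  ... | yes px = ⊥-elim (¬px px)
  ... | no _ = refl

  count⇒∃-subset : ∀ {m} (f : Fin m → A) {k} → k ≤ count P? (tabulate f) →
                   Σ (Subset m) λ B → ∣ B ∣ ≡ k × (∀ {i} → i ∈ B → P (f i))
  count⇒∃-subset {m} f {zero} _ = ⊥ , Subset.∣⊥∣≡0 m , λ i∈⊥ → ⊥-elim (Subset.∉⊥ i∈⊥)
  count⇒∃-subset {suc m} f {suc k} k<count with P? (f zero)
  ... | yes p = let B , ∣B∣≡k , B⊆P = count⇒∃-subset (f ∘ suc) (ℕ.s≤s⁻¹ k<count)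
                in true ∷ B , cong suc ∣B∣≡k , λ { here → p ; (there i∈B) → B⊆P i∈B }
  ... | no _ = let B , ∣B∣≡k , B⊆P = count⇒∃-subset (f ∘ suc) k<count
               in false ∷ B , ∣B∣≡k , λ { (there i∈B) → B⊆P i∈B }

count-⊎ : {P : Pred A ℓ} {Q : Pred A ℓ₁} {R : Pred A ℓ₂}
          (P? : Decidable P) (Q? : Decidable Q) (R? : Decidable R) →
          (∀ {x} → P x → Q x ⊎ R x) →
          ∀ {n} (xs : Vec A n) → count P? xs ≤ count Q? xs ℕ.+ count R? xs
count-⊎ P? Q? R? split [] = z≤n
count-⊎ P? Q? R? split (x ∷ xs) with P? x
... | no _ = ℕ.≤-trans (count-⊎ P? Q? R? split xs) (ℕ.+-mono-≤ (count-∷ Q? x xs) (count-∷ R? x xs))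
... | yes px with split px
...   | inj₁ qx = ℕ.≤-trans (s≤s (count-⊎ P? Q? R? split xs))
                    (ℕ.+-mono-≤ (ℕ.≤-reflexive (sym (count-∷-yes Q? xs qx))) (count-∷ R? x xs))
...   | inj₂ rx = ℕ.≤-trans (s≤s (count-⊎ P? Q? R? split xs))
                    (ℕ.≤-trans (ℕ.≤-reflexive (sym (ℕ.+-suc (count Q? xs) (count R? xs))))
                      (ℕ.+-mono-≤ (count-∷ Q? x xs) (ℕ.≤-reflexive (sym (count-∷-yes R? xs rx)))))

Positive≤ : ℕ → Pred ℤ 0ℓ
Positive≤ a x = + 0 <ℤ x × x ≤ℤ + a

positive≤? : ∀ a → Decidable (Positive≤ a)
positive≤? a x = (+ 0 ℤ.<? x) ×-dec (x ℤ.≤? + a)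

¬Positive≤0 : ∀ x → ¬ Positive≤ 0 x
¬Positive≤0 x (0<x , x≤0) = ℤ.<⇒≱ 0<x x≤0

Positive≤-suc : ∀ {a x} → Positive≤ (suc a) x → x ≡ + suc a ⊎ Positive≤ a x
Positive≤-suc {a} {x} (0<x , x≤1+a) with x ℤ.≟ + suc a
... | yes x≡1+a = inj₁ x≡1+a
... | no x≢1+a = inj₂ (0<x , ℤ.i<j⇒i≤pred[j] (ℤ.≤∧≢⇒< x≤1+a x≢1+a))

¬Positive≤⇒negative : ∀ {Y x} → x ≢ + 0 → ∣ x ∣ℤ ≤ Y → ¬ Positive≤ Y x → x <ℤ + 0
¬Positive≤⇒negative {x = + zero} x≢0 _ _ = ⊥-elim (x≢0 refl)
¬Positive≤⇒negative {x = + suc k} _ ∣x∣≤Y ¬pos = ⊥-elim (¬pos (ℤ.+<+ (s≤s z≤n) , ℤ.+≤+ ∣x∣≤Y))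
¬Positive≤⇒negative {x = -[1+ k ]} _ _ _ = ℤ.-<+

pigeonhole : ∀ a K {n} (xs : Vec ℤ n) →
             count (positive≤? a) xs ≤ a * K ⊎ ∃ λ k → k < a × K < count (ℤ._≟ + suc k) xs
pigeonhole zero K xs = inj₁ (ℕ.≤-reflexive (count-none (positive≤? 0) ¬Positive≤0 xs))
pigeonhole (suc a) K xs with count (ℤ._≟ + suc a) xs ℕ.≤? K
... | no many = inj₂ (a , ℕ.≤-refl , ℕ.≰⇒> many)
... | yes few with pigeonhole a K xs
...   | inj₁ fewer = inj₁ (ℕ.≤-trans (count-⊎ (positive≤? (suc a)) (ℤ._≟ + suc a) (positive≤? a) Positive≤-suc xs)
                                    (ℕ.+-mono-≤ few fewer))
...   | inj₂ (k , k<a , many) = inj₂ (k , ℕ.m≤n⇒m≤1+n k<a , many)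

size+sum≤count-positive : ∀ Y {m} (f : Fin m → ℤ) → (∀ i → f i ≢ + 0) → (∀ i → ∣ f i ∣ℤ ≤ Y) →
                          + m +ℤ sumOver ⊤ f ≤ℤ + (suc Y * count (positive≤? Y) (tabulate f))
size+sum≤count-positive Y {zero} f _ _ = ℤ.+≤+ z≤n
size+sum≤count-positive Y {suc m} f nonzero bounded =
  let d , 1+f₀≤d , counted = head in
  ℤ.≤-trans (ℤ.≤-reflexive (interchange (+ 1) (+ m) (f zero) (sumOver ⊤ (f ∘ suc))))
    (ℤ.≤-trans (ℤ.+-mono-≤ 1+f₀≤d rest) (ℤ.≤-reflexive (cong +_ (sym counted))))
  where
  P? = positive≤? Y
  xs = tabulate (f ∘ suc)
  rest = size+sum≤count-positive Y (f ∘ suc) (nonzero ∘ suc) (bounded ∘ suc)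
  -- d is (Y + 1)·[0 < f 0 ≤ Y]; the bound 1 + f 0 ≤ d needs f 0 ≢ 0 and ∣f 0∣ ≤ Y.
  head : Σ ℕ λ d → + 1 +ℤ f zero ≤ℤ + d × suc Y * count P? (tabulate f) ≡ d ℕ.+ suc Y * count P? xs
  head with P? (f zero)
  ... | yes pos@(_ , f₀≤Y) =
    suc Y , ℤ.+-monoʳ-≤ (+ 1) f₀≤Y ,
    trans (cong (suc Y *_) (count-∷-yes P? xs pos)) (ℕ.*-suc (suc Y) (count P? xs))
  ... | no ¬pos =
    0 , ℤ.i<j⇒suc[i]≤j (¬Positive≤⇒negative (nonzero zero) (bounded zero) ¬pos) ,
    cong (suc Y *_) (count-∷-no P? xs ¬pos)

frequent-positive-value : ∀ y {m} (f : Fin m → ℤ) → (∀ i → f i ≢ + 0) → (∀ i → ∣ f i ∣ℤ ≤ suc y) →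
                          sumOver ⊤ f ≡ + 0 → suc y ^ 3 < m →
                          ∃ λ k → k < suc y × suc y ≤ count (ℤ._≟ + suc k) (tabulate f)
frequent-positive-value y {m} f nonzero bounded sum≡0 large with pigeonhole (suc y) y (tabulate f)
... | inj₂ frequent = frequent
... | inj₁ few = ⊥-elim (ℕ.<⇒≱ large (begin
  m                                          ≤⟨ m≤ ⟩
  suc Y * count (positive≤? Y) (tabulate f)  ≤⟨ ℕ.*-monoʳ-≤ (suc Y) few ⟩
  suc Y * (Y * y)                            ≤⟨ ℕ.m≤m+n (suc Y * (Y * y)) Y ⟩
  suc Y * (Y * y) ℕ.+ Y                      ≡⟨ cube y ⟩
  Y ^ 3                                      ∎))
  where
  open ℕ.≤-Reasoning
  Y = suc y
  m≤ : m ≤ suc Y * count (positive≤? Y) (tabulate f)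
  m≤ = ℤ.drop‿+≤+ (ℤ.≤-trans (ℤ.≤-reflexive (sym (trans (cong (+ m +ℤ_) sum≡0) (ℤ.+-identityʳ (+ m)))))
                              (size+sum≤count-positive Y f nonzero bounded))
  cube : ∀ y → (2 ℕ.+ y) * ((1 ℕ.+ y) * y) ℕ.+ (1 ℕ.+ y) ≡ (1 ℕ.+ y) ^ 3
  cube = solve 1 (λ y → (con 2 :+ y) :* ((con 1 :+ y) :* y) :+ (con 1 :+ y) := (con 1 :+ y) :^ 3) refl
    where open +-*-Solver

balanced-subset : ∀ a b {m} (f : Fin m → ℤ) →
                  suc b ≤ count (ℤ._≟ + suc a) (tabulate f) →
                  suc a ≤ count (ℤ._≟ + suc b) (tabulate (-_ ∘ f)) →
                  Σ (Subset m) λ B → Nonempty B × ∣ B ∣ ≤ suc b ℕ.+ suc a × sumOver B f ≡ + 0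
balanced-subset a b f many-a many-b
  with count⇒∃-subset (ℤ._≟ + suc a) f many-a | count⇒∃-subset (ℤ._≟ + suc b) (-_ ∘ f) many-b
... | B , ∣B∣≡1+b , B⊆a | C , ∣C∣≡1+a , C⊆b = B ∪ C , nonempty , size , sum
  where
  C⊆-b : ∀ {i} → i ∈ C → f i ≡ -[1+ b ]
  C⊆-b {i} i∈C = trans (sym (ℤ.neg-involutive (f i))) (cong -_ (C⊆b i∈C))
  disjoint : Disjoint B C
  disjoint i i∈B i∈C with trans (sym (B⊆a i∈B)) (C⊆-b i∈C)
  ... | ()
  nonempty : Nonempty (B ∪ C)
  nonempty = let i , i∈B = 0<∣p∣⇒Nonempty B (subst (0 <_) (sym ∣B∣≡1+b) (s≤s z≤n))
             in i , Subset.x∈p∪q⁺ (inj₁ i∈B)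
  size : ∣ B ∪ C ∣ ≤ suc b ℕ.+ suc a
  size = ℕ.≤-trans (∣p∪q∣≤∣p∣+∣q∣ B C) (ℕ.≤-reflexive (cong₂ ℕ._+_ ∣B∣≡1+b ∣C∣≡1+a))
  sum : sumOver (B ∪ C) f ≡ + 0
  sum = begin
    sumOver (B ∪ C) f                               ≡⟨ sumOver-∪ B C f disjoint ⟩
    sumOver B f +ℤ sumOver C f                      ≡⟨ cong₂ _+ℤ_ (sumOver-const B f B⊆a) (sumOver-const C f C⊆-b) ⟩
    + ∣ B ∣ *ℤ + suc a +ℤ + ∣ C ∣ *ℤ - + suc b      ≡⟨ cong₂ (λ k l → + k *ℤ + suc a +ℤ + l *ℤ - + suc b) ∣B∣≡1+b ∣C∣≡1+a ⟩
    + suc b *ℤ + suc a +ℤ + suc a *ℤ - + suc b      ≡⟨ cong₂ _+ℤ_ (ℤ.*-comm (+ suc b) (+ suc a)) (sym (ℤ.neg-distribʳ-* (+ suc a) (+ suc b))) ⟩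
    + suc a *ℤ + suc b +ℤ - (+ suc a *ℤ + suc b)    ≡⟨ ℤ.+-inverseʳ (+ suc a *ℤ + suc b) ⟩
    + 0                                             ∎
    where open ≡-Reasoning

2n≤2n³ : ∀ n → 2 * n ≤ 2 * n ^ 3
2n≤2n³ zero = z≤n
2n≤2n³ (suc n) = ℕ.*-monoʳ-≤ 2 (ℕ.m≤m*n (suc n) (suc n ^ 2))

zero-sum-subfamily : ∀ y {m} (f : Fin m → ℤ) → 1 ≤ m → sumOver ⊤ f ≡ + 0 → (∀ i → ∣ f i ∣ℤ ≤ suc y) →
                     Σ (Subset m) λ B → Nonempty B × ∣ B ∣ ≤ 2 * suc y ^ 3 × sumOver B f ≡ + 0
zero-sum-subfamily y {suc m} f (s≤s z≤n) sum≡0 bounded with any? (λ i → f i ℤ.≟ + 0)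
... | yes (i , fi≡0) =
  ⁅ i ⁆ , (i , Subset.x∈⁅x⁆ i) ,
  subst (_≤ 2 * suc y ^ 3) (sym (Subset.∣⁅x⁆∣≡1 i)) (ℕ.≤-trans (s≤s z≤n) (2n≤2n³ (suc y))) ,
  trans (sumOver-const ⁅ i ⁆ f (λ j∈⁅i⁆ → trans (cong f (Subset.x∈⁅y⁆⇒x≡y i j∈⁅i⁆)) fi≡0)) (ℤ.*-zeroʳ (+ ∣ ⁅ i ⁆ ∣))
... | no no-zero with suc m ℕ.≤? 2 * suc y ^ 3
...   | yes small = ⊤ , (zero , here) , subst (_≤ 2 * suc y ^ 3) (sym (Subset.∣⊤∣≡n (suc m))) small , sum≡0
...   | no large =
  let a , a<Y , many-a = frequent-positive-value y f nonzero bounded sum≡0 Y³<m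
      b , b<Y , many-b = frequent-positive-value y (-_ ∘ f) (λ i → nonzero i ∘ ℤ.neg-injective)
                           (λ i → subst (_≤ suc y) (sym (ℤ.∣-i∣≡∣i∣ (f i))) (bounded i))
                           (trans (sumOver-neg ⊤ f) (cong -_ sum≡0)) Y³<m
      B , nonempty , size , sum = balanced-subset a b f (ℕ.≤-trans b<Y many-a) (ℕ.≤-trans a<Y many-b)
  in B , nonempty , ℕ.≤-trans size (ℕ.≤-trans (ℕ.+-mono-≤ b<Y (ℕ.m≤n⇒m≤n+o 0 a<Y)) (2n≤2n³ (suc y))) , sum
  where
  nonzero : ∀ i → f i ≢ + 0
  nonzero i fi≡0 = no-zero (i , fi≡0)
  Y³<m : suc y ^ 3 < suc m
  Y³<m = ℕ.≤-<-trans (ℕ.m≤m+n (suc y ^ 3) _) (ℕ.≰⇒> large)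

∣μ∣≤∣A∣ : ∀ {n} (O S A : Subset n) → ∣ μ O S A ∣ℤ ≤ ∣ A ∣
∣μ∣≤∣A∣ O S A = begin
  ∣ μ O S A ∣ℤ                      ≡⟨ cong ∣_∣ℤ (ℤ.m-n≡m⊖n ∣ A ∩ O ∣ ∣ A ∩ S ∣) ⟩
  ∣ ∣ A ∩ O ∣ ℤ.⊖ ∣ A ∩ S ∣ ∣ℤ        ≤⟨ ℤ.∣m⊝n∣≤m⊔n ∣ A ∩ O ∣ ∣ A ∩ S ∣ ⟩
  ∣ A ∩ O ∣ ℕ.⊔ ∣ A ∩ S ∣            ≤⟨ ℕ.⊔-lub (Subset.∣p∩q∣≤∣p∣ A O) (Subset.∣p∩q∣≤∣p∣ A S) ⟩
  ∣ A ∣                              ∎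
  where open ℕ.≤-Reasoning

-- Only ∣μ(A)∣ ≤ ∣A∣ ≤ Y is used.
lemma9 : (n : ℕ) (O S : Subset n) → Disjoint O S →
    (Y : ℕ) → 1 ≤ Y →
    (m : ℕ) → 1 ≤ m → (𝒜 : Fin m → Subset n) →
    (∀ i j → i ≢ j → Disjoint (𝒜 i) (𝒜 j)) →
    (∀ i → Nonempty (𝒜 i)) →
    (∀ i → 𝒜 i ⊆ O ∪ S) →
    sumOver ⊤ (λ i → μ O S (𝒜 i)) ≡ + 0 →
    (∀ i → ∣ 𝒜 i ∣ ≤ Y) →
    Σ (Subset m) λ ℬ → Nonempty ℬ × ∣ ℬ ∣ ≤ 2 * Y ^ 3 × sumOver ℬ (λ i → μ O S (𝒜 i)) ≡ + 0
lemma9 n O S _ (suc y) (s≤s z≤n) m 1≤m 𝒜 _ _ _ sum≡0 ∣𝒜∣≤Y =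
  zero-sum-subfamily y (μ O S ∘ 𝒜) 1≤m sum≡0 (λ i → ℕ.≤-trans (∣μ∣≤∣A∣ O S (𝒜 i)) (∣𝒜∣≤Y i))
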